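{- Let $G$ be a connected finite simple graph with $\mathrm{ind\text{ - }match}(G)=1$. Then $|E(G)|\ge\binom{\mathrm{match}(G)+1}{2}$. In particular, for integers $1\le q\le r\le 2q$, every connected graph $G$ with $\mathrm{ind\text{ - }match}(G)=1$, $\mathrm{min\text{ - }match}(G)=q$, $\mathrm{match}(G)=r$ has $|E(G)|\ge\binom{r+1}{2}$.
   Context: A matching is a set of pairwise disjoint edges; a maximal matching is one not properly contained in another matching; an induced matching is a matching $M$ such that for distinct $e,f\in M$ there is no edge meeting both $e$ and $f$. $\mathrm{match}(G)$, $\mathrm{min\text{ - }match}(G)$, $\mathrm{ind\text{ - }match}(G)$ are the maximum size of a matching, the minimum size of a maximal matching, and the maximum size of an induced matching, respectively. -}

module Defs where

open import Data.Nat using (ℕ)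
open import Data.Bool using (Bool; true; false)
open import Data.Fin using (Fin; _<_; _<?_)
open import Data.List using (List; length; filter; cartesianProduct; allFin)
open import Data.List.Membership.Propositional using (_∈_)
open import Data.List.Relation.Unary.All using (All)
open import Data.List.Relation.Unary.AllPairs using (AllPairs)
open import Data.Product using (_×_; _,_; Σ; ∃)
open import Data.Empty using (⊥)
open import Relation.Binary.PropositionalEquality using (_≡_; _≢_)
open import Relation.Nullary using (¬_; Dec)
open import Relation.Nullary.Decidable using (_×-dec_)
open import Data.Bool.Properties using () renaming (_≟_ to _≟ᵇ_)

record Graph : Set where
  field
    n     : ℕ
    adj   : Fin n → Fin n → Bool
    sym   : ∀ u v → adj u v ≡ adj v u
    irrefl : ∀ u → adj u u ≡ false
open Graph public

IsEdge : (G : Graph) → Fin (n G) × Fin (n G) → Set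
IsEdge G (u , v) = (u < v) × (adj G u v ≡ true)

isEdge? : (G : Graph) → (e : Fin (n G) × Fin (n G)) → Dec (IsEdge G e)
isEdge? G (u , v) = (u <? v) ×-dec (adj G u v ≟ᵇ true)

edges : (G : Graph) → List (Fin (n G) × Fin (n G))
edges G = filter (isEdge? G) (cartesianProduct (allFin (n G)) (allFin (n G)))

edgeCount : Graph → ℕ
edgeCount G = length (edges G)

Disjoint : {m : ℕ} → Fin m × Fin m → Fin m × Fin m → Set
Disjoint (a , b) (c , d) = (a ≢ c) × (a ≢ d) × (b ≢ c) × (b ≢ d)

IsMatching : (G : Graph) → List (Fin (n G) × Fin (n G)) → Set
IsMatching G M = All (IsEdge G) M × AllPairs Disjoint M

NoEdgeBetween : (G : Graph) → Fin (n G) × Fin (n G) → Fin (n G) × Fin (n G) → Set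
NoEdgeBetween G (a , b) (c , d) =
  (adj G a c ≡ false) × (adj G a d ≡ false) × (adj G b c ≡ false) × (adj G b d ≡ false)

IsInducedMatching : (G : Graph) → List (Fin (n G) × Fin (n G)) → Set
IsInducedMatching G M = IsMatching G M × AllPairs (NoEdgeBetween G) M

IsMaximalMatching : (G : Graph) → List (Fin (n G) × Fin (n G)) → Set
IsMaximalMatching G M =
  IsMatching G M ×
  (∀ M' → IsMatching G M' → (∀ {e} → e ∈ M → e ∈ M') → (∀ {e} → e ∈ M' → e ∈ M))

MatchNumber : Graph → ℕ → Set
MatchNumber G r =
  (Σ _ λ M → IsMatching G M × length M ≡ r) ×
  (∀ M → IsMatching G M → length M Data.Nat.≤ r)

IndMatchNumber : Graph → ℕ → Set
IndMatchNumber G r =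
  (Σ _ λ M → IsInducedMatching G M × length M ≡ r) ×
  (∀ M → IsInducedMatching G M → length M Data.Nat.≤ r)

MinMatchNumber : Graph → ℕ → Set
MinMatchNumber G q =
  (Σ _ λ M → IsMaximalMatching G M × length M ≡ q) ×
  (∀ M → IsMaximalMatching G M → q Data.Nat.≤ length M)

data Reach (G : Graph) : Fin (n G) → Fin (n G) → Set where
  here : ∀ {u} → Reach G u u
  step : ∀ {u w v} → adj G u w ≡ true → Reach G w v → Reach G u v

Connected : Graph → Set
Connected G = ∀ u v → Reach G u v

{-# OPTIONS --safe #-}
module Submission where

-- Take a maximum matching M, of size r. As ind-match(G) = 1, any two edges e, f of M are
-- joined by an edge of G with one endpoint in e and the other in f. The r edges of M together
-- with one such link for each of the C(r,2) pairs give r + C(r,2) = C(r+1,2) edges. They are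
-- pairwise distinct, as each is determined by the edges of M it meets: an edge of M meets only
-- itself, the link chosen for {e, f} exactly e and f.

open import Defs hiding (sym)
open import Data.Nat using (ℕ; suc; _≤_; _+_; _*_; z≤n; s≤s)
open import Data.Nat.Properties using (+-comm; n≮n; module ≤-Reasoning)
open import Data.Nat.Combinatorics using (_C_; nC1≡n; nCk+nC[k+1]≡[n+1]C[k+1])
open import Data.Product using (_×_; _,_; proj₁; ∃; ∃-syntax)
open import Data.Sum using (_⊎_; inj₁; inj₂)
open import Data.Bool using (true; false)
open import Data.Empty using (⊥; ⊥-elim)
open import Data.Fin using (Fin)
open import Data.Fin.Properties using (<-cmp)
open import Data.List using (List; []; _∷_; _++_; length)
open import Data.List.Properties using (length-++; length-removeAt′)
open import Data.List.Relation.Unary.All as All using (All; []; _∷_)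
import Data.List.Relation.Unary.All.Properties as All
open import Data.List.Relation.Unary.Any using (Any; here; there; index)
open import Data.List.Relation.Unary.AllPairs using (AllPairs; []; _∷_)
import Data.List.Relation.Unary.AllPairs.Properties as AllPairs
open import Data.List.Relation.Unary.Unique.Propositional using (Unique)
open import Data.List.Relation.Binary.Subset.Propositional using (_⊆_)
open import Data.List.Relation.Binary.Subset.Propositional.Properties using (Any-resp-⊆; xs⊆x∷xs)
open import Data.List.Membership.Propositional using (_∈_; _─_)
open import Data.List.Membership.Propositional.Properties using (∈-filter⁺; ∈-cartesianProduct⁺; ∈-allFin)
open import Relation.Binary using (tri<; tri≈; tri>)
open import Relation.Binary.PropositionalEquality using (_≡_; _≢_; refl; sym; trans; cong; cong₂; subst; ≢-sym; module ≡-Reasoning)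
open import Relation.Nullary using (¬_)

module _ {a} {A : Set a} where

  ∈-─⁺ : ∀ {x y} {xs : List A} (x∈xs : x ∈ xs) → y ∈ xs → y ≢ x → y ∈ xs ─ x∈xs
  ∈-─⁺ (here refl)  (here refl)  y≢x = ⊥-elim (y≢x refl)
  ∈-─⁺ (here _)     (there y∈xs) _   = y∈xs
  ∈-─⁺ (there _)    (here refl)  _   = here refl
  ∈-─⁺ (there x∈xs) (there y∈xs) y≢x = there (∈-─⁺ x∈xs y∈xs y≢x)

  unique⊆⇒length≤ : ∀ {xs ys : List A} → Unique xs → xs ⊆ ys → length xs ≤ length ys
  unique⊆⇒length≤ {[]} _ _ = z≤n
  unique⊆⇒length≤ {x ∷ xs} {ys} (x∉xs ∷ xs-unique) x∷xs⊆ys = begin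
    suc (length xs)            ≤⟨ s≤s (unique⊆⇒length≤ xs-unique xs⊆ys─x) ⟩
    suc (length (ys ─ x∈ys))   ≡⟨ sym (length-removeAt′ ys (index x∈ys)) ⟩
    length ys                  ∎
    where
    open ≤-Reasoning
    x∈ys : x ∈ ys
    x∈ys = x∷xs⊆ys (here refl)
    xs⊆ys─x : xs ⊆ ys ─ x∈ys
    xs⊆ys─x y∈xs = ∈-─⁺ x∈ys (x∷xs⊆ys (there y∈xs)) (≢-sym (All.lookup x∉xs y∈xs))

module _ {m : ℕ} where

  Pair : Set
  Pair = Fin m × Fin m

  _∈ᵉ_ : Fin m → Pair → Set
  v ∈ᵉ (a , b) = v ≡ a ⊎ v ≡ b

  Meets : Pair → Pair → Set
  Meets p e = ∃[ v ] v ∈ᵉ p × v ∈ᵉ e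

  SpannedBy : List Pair → Pair → Set
  SpannedBy K p = ∀ {v} → v ∈ᵉ p → Any (v ∈ᵉ_) K

  meets-refl : ∀ e → Meets e e
  meets-refl (a , _) = a , inj₁ refl , inj₁ refl

  spanned-mono : ∀ {K K′ p} → K ⊆ K′ → SpannedBy K p → SpannedBy K′ p
  spanned-mono K⊆K′ p⊆K v∈p = Any-resp-⊆ K⊆K′ (p⊆K v∈p)

  Disjoint-sym : ∀ {e f : Pair} → Disjoint e f → Disjoint f e
  Disjoint-sym (a≢c , a≢d , b≢c , b≢d) = ≢-sym a≢c , ≢-sym b≢c , ≢-sym a≢d , ≢-sym b≢d

  disjoint⇒¬shared : ∀ {e f v} → Disjoint e f → v ∈ᵉ e → v ∈ᵉ f → ⊥
  disjoint⇒¬shared (a≢c , _ , _ , _) (inj₁ refl) (inj₁ refl) = a≢c refl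
  disjoint⇒¬shared (_ , a≢d , _ , _) (inj₁ refl) (inj₂ refl) = a≢d refl
  disjoint⇒¬shared (_ , _ , b≢c , _) (inj₂ refl) (inj₁ refl) = b≢c refl
  disjoint⇒¬shared (_ , _ , _ , b≢d) (inj₂ refl) (inj₂ refl) = b≢d refl

  meets⇒≢spanned : ∀ {f p q K} → Meets p f → All (Disjoint f) K → SpannedBy K q → p ≢ q
  meets⇒≢spanned (v , v∈p , v∈f) f#K q⊆K refl =
    All.lookupWith (λ f#g v∈g → disjoint⇒¬shared f#g v∈f v∈g) f#K (q⊆K v∈p)

module _ (G : Graph) where

  Link : Pair → Pair → Pair → Set
  Link e f (u , w) = IsEdge G (u , w) × (u ∈ᵉ e × w ∈ᵉ f ⊎ u ∈ᵉ f × w ∈ᵉ e)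

  Linked : Pair → Pair → Set
  Linked e f = ∃ (Link e f)

  module _ {e f : Pair {n G}} where

    link-meetsˡ : ∀ {p} → Link e f p → Meets p e
    link-meetsˡ {u , _} (_ , inj₁ (u∈e , _)) = u , inj₁ refl , u∈e
    link-meetsˡ {_ , w} (_ , inj₂ (_ , w∈e)) = w , inj₂ refl , w∈e

    link-meetsʳ : ∀ {p} → Link e f p → Meets p f
    link-meetsʳ {_ , w} (_ , inj₁ (_ , w∈f)) = w , inj₂ refl , w∈f
    link-meetsʳ {u , _} (_ , inj₂ (u∈f , _)) = u , inj₁ refl , u∈f

    link-spanned : ∀ {p} → Link e f p → SpannedBy (e ∷ f ∷ []) p
    link-spanned (_ , inj₁ (u∈e , _)) (inj₁ refl) = here u∈e
    link-spanned (_ , inj₁ (_ , w∈f)) (inj₂ refl) = there (here w∈f)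
    link-spanned (_ , inj₂ (u∈f , _)) (inj₁ refl) = there (here u∈f)
    link-spanned (_ , inj₂ (_ , w∈e)) (inj₂ refl) = here w∈e

    orient : ∀ {u w} → u ∈ᵉ e → w ∈ᵉ f → adj G u w ≡ true → Linked e f
    orient {u} {w} u∈e w∈f u~w with <-cmp u w
    ... | tri< u<w _ _ = (u , w) , (u<w , u~w) , inj₁ (u∈e , w∈f)
    ... | tri> _ _ w<u = (w , u) , (w<u , trans (Graph.sym G w u) u~w) , inj₂ (w∈f , u∈e)
    ... | tri≈ _ refl _ with () ← trans (sym u~w) (irrefl G u)

  joined⇒linked : ∀ {e f} → ¬ NoEdgeBetween G e f → Linked e f
  joined⇒linked {a , b} {c , d} joined
    with adj G a c in a~c | adj G a d in a~d | adj G b c in b~c | adj G b d in b~d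
  ... | true  | _     | _     | _     = orient (inj₁ refl) (inj₁ refl) a~c
  ... | false | true  | _     | _     = orient (inj₁ refl) (inj₂ refl) a~d
  ... | false | false | true  | _     = orient (inj₂ refl) (inj₁ refl) b~c
  ... | false | false | false | true  = orient (inj₂ refl) (inj₂ refl) b~d
  ... | false | false | false | false = ⊥-elim (joined (refl , refl , refl , refl))

  indMatch≤1⇒joined : (∀ M → IsInducedMatching G M → length M ≤ 1) →
                      ∀ {e f} → IsEdge G e → IsEdge G f → Disjoint e f → ¬ NoEdgeBetween G e f
  indMatch≤1⇒joined ind≤1 {e} {f} ie if e#f e≁f =
    n≮n 1 (ind≤1 (e ∷ f ∷ []) ((ie ∷ if ∷ [] , (e#f ∷ []) ∷ [] ∷ []) , (e≁f ∷ []) ∷ [] ∷ []))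

  indMatch≤1⇒linked : (∀ M → IsInducedMatching G M → length M ≤ 1) →
                      ∀ {M} → IsMatching G M → AllPairs Linked M
  indMatch≤1⇒linked ind≤1 ([]       , [])          = []
  indMatch≤1⇒linked ind≤1 (ie ∷ ies , e#M ∷ M#M) =
    All.zipWith (λ (if , e#f) → joined⇒linked (indMatch≤1⇒joined ind≤1 ie if e#f)) (ies , e#M)
      ∷ indMatch≤1⇒linked ind≤1 (ies , M#M)

  module _ {e : Pair {n G}} where

    links : ∀ {M} → All (Linked e) M → List (Pair {n G})
    links = All.reduce proj₁

    length-links : ∀ {M} (ls : All (Linked e) M) → length (links ls) ≡ length M
    length-links []       = refl
    length-links (_ ∷ ls) = cong suc (length-links ls)

    links⁺ : ∀ {M} {Q : Pair → Set} → (∀ {f p} → f ∈ M → Link e f p → Q p) →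
             (ls : All (Linked e) M) → All Q (links ls)
    links⁺ h []             = []
    links⁺ h ((_ , l) ∷ ls) = h (here refl) l ∷ links⁺ (λ f∈M → h (there f∈M)) ls

    links-spanned : ∀ {M} (ls : All (Linked e) M) → All (SpannedBy (e ∷ M)) (links ls)
    links-spanned = links⁺ λ f∈M l →
      spanned-mono (λ { (here refl) → here refl ; (there (here refl)) → there f∈M }) (link-spanned l)

    links-unique : ∀ {M} → All (Disjoint e) M → AllPairs Disjoint M →
                   (ls : All (Linked e) M) → Unique (links ls)
    links-unique []          []          []             = []
    links-unique (e#f ∷ e#M) (f#M ∷ M#M) ((_ , l) ∷ ls) =
      All.map (meets⇒≢spanned (link-meetsʳ l) (Disjoint-sym e#f ∷ f#M)) (links-spanned ls)
        ∷ links-unique e#M M#M ls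

    links-∌ : ∀ {M} → All (Disjoint e) M → (ls : All (Linked e) M) → All (e ≢_) (links ls)
    links-∌ e#M = links⁺ λ f∈M l →
      ≢-sym (meets⇒≢spanned (link-meetsʳ l) (Disjoint-sym (All.lookup e#M f∈M) ∷ []) here)

  withLinks : ∀ {M} → AllPairs Linked M → List (Pair {n G})
  withLinks []                 = []
  withLinks {e ∷ _} (ls ∷ lss) = e ∷ links ls ++ withLinks lss

  length-withLinks : ∀ {M} (lss : AllPairs Linked M) → length (withLinks lss) ≡ suc (length M) C 2
  length-withLinks []                 = refl
  length-withLinks {_ ∷ M} (ls ∷ lss) = begin
    suc (length (links ls ++ withLinks lss))          ≡⟨ cong suc (length-++ (links ls)) ⟩
    suc (length (links ls) + length (withLinks lss))  ≡⟨ cong₂ (λ i j → suc i + j) (length-links ls)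
                                                                                (length-withLinks lss) ⟩
    r + r C 2                                         ≡⟨ cong (_+ r C 2) (sym (nC1≡n r)) ⟩
    r C 1 + r C 2                                     ≡⟨ nCk+nC[k+1]≡[n+1]C[k+1] r 1 ⟩
    suc r C 2                                         ∎
    where
    open ≡-Reasoning
    r : ℕ
    r = suc (length M)

  withLinks-edges : ∀ {M} → All (IsEdge G) M → (lss : AllPairs Linked M) →
                    All (IsEdge G) (withLinks lss)
  withLinks-edges []         []         = []
  withLinks-edges (ie ∷ ies) (ls ∷ lss) =
    ie ∷ All.++⁺ (links⁺ (λ _ → proj₁) ls) (withLinks-edges ies lss)

  withLinks-spanned : ∀ {M} (lss : AllPairs Linked M) → All (SpannedBy M) (withLinks lss)
  withLinks-spanned []                 = []
  withLinks-spanned {e ∷ _} (ls ∷ lss) =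
    here ∷ All.++⁺ (links-spanned ls) (All.map (spanned-mono (xs⊆x∷xs _ e)) (withLinks-spanned lss))

  -- e and its links all meet e; every later entry is spanned by the rest of M, which avoids e.
  withLinks-unique : ∀ {M} → AllPairs Disjoint M → (lss : AllPairs Linked M) → Unique (withLinks lss)
  withLinks-unique []          []         = []
  withLinks-unique (e#M ∷ M#M) (ls ∷ lss) =
    AllPairs.++⁺ (links-∌ e#M ls ∷ links-unique e#M M#M ls) (withLinks-unique M#M lss)
      (All.map (λ meets-e → All.map (meets⇒≢spanned meets-e e#M) (withLinks-spanned lss))
               (meets-refl _ ∷ links⁺ (λ _ → link-meetsˡ) ls))

  IsEdge⇒∈edges : ∀ {p} → IsEdge G p → p ∈ edges G
  IsEdge⇒∈edges {u , v} = ∈-filter⁺ (isEdge? G) (∈-cartesianProduct⁺ (∈-allFin u) (∈-allFin v))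

  linked-matching⇒[r+1]C2≤edgeCount : ∀ {M} → IsMatching G M → AllPairs Linked M →
                                      suc (length M) C 2 ≤ edgeCount G
  linked-matching⇒[r+1]C2≤edgeCount {M} (ies , M#M) lss = begin
    suc (length M) C 2      ≡⟨ sym (length-withLinks lss) ⟩
    length (withLinks lss)  ≤⟨ unique⊆⇒length≤ (withLinks-unique M#M lss) withLinks⊆edges ⟩
    edgeCount G             ∎
    where
    open ≤-Reasoning
    withLinks⊆edges : withLinks lss ⊆ edges G
    withLinks⊆edges p∈ = IsEdge⇒∈edges (All.lookup (withLinks-edges ies lss) p∈)

indMatch1⇒[r+1]C2≤edgeCount : (G : Graph) (r : ℕ) → IndMatchNumber G 1 → MatchNumber G r →
                              (r + 1) C 2 ≤ edgeCount G
indMatch1⇒[r+1]C2≤edgeCount G _ (_ , ind≤1) ((M , M-matching , refl) , _) =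
  subst (λ k → k C 2 ≤ edgeCount G) (+-comm 1 (length M))
    (linked-matching⇒[r+1]C2≤edgeCount G M-matching (indMatch≤1⇒linked G ind≤1 M-matching))

lemma1p11 :
    ((G : Graph) (r : ℕ) → Connected G → IndMatchNumber G 1 → MatchNumber G r →
      (r + 1) C 2 ≤ edgeCount G)
    ×
    ((q r : ℕ) → 1 ≤ q → q ≤ r → r ≤ 2 * q →
      (G : Graph) → Connected G → IndMatchNumber G 1 → MinMatchNumber G q → MatchNumber G r →
      (r + 1) C 2 ≤ edgeCount G)
lemma1p11 =
  (λ G r _ → indMatch1⇒[r+1]C2≤edgeCount G r) ,
  (λ _ r _ _ _ G _ ind _ match → indMatch1⇒[r+1]C2≤edgeCount G r ind match)
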